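{- Let $n$ be a variable. For schemata $S_1,S_2$ both having $n$ as a parameter, if $S_1=S_2\{n-k/n\}$ (syntactic equality) for some integer $k>0$, then $S_1$ loops on $S_2$. In other words, the restriction of equality up to a shift on $n$ to schemata having $n$ as a parameter is a looping refinement.
   Context: Schemata are pairs $P\wedge\varphi_S$ of a pattern $P$ (propositional formula over indexed propositions $p_{e_1,\dots,e_k}$ whose indices are linear integer expressions, closed under $\wedge,\vee$ and iterated connectives $\bigwedge_{i\mid\varphi}$, $\bigvee_{i\mid\varphi}$ over constraints $\varphi$ enclosing the bound variable $i$) and a constraint $\varphi_S$ of linear integer arithmetic. Parameters are the free variables of the pattern. An environment of $S$ is a ground substitution $\rho$ of its parameters with $\varphi_S\rho$ true; $[S]_\rho$ is the propositional formula obtained by expanding iterations over the integers satisfying their domains. An interpretation $I$ is an environment $\rho_I$ plus a propositional interpretation; $I$ is a model of $S$ iff $[S]_{\rho_I}$ is true in it. The substitution $\{n-k/n\}$ replaces free occurrences of $n$ (including in the constraint). Looping: for schemata $S_1,S_2$ with the same parameters $n_1,\dots,n_k$, $S_1$ loops on $S_2$ iff for every model $I$ of $S_1$ there is a model $J$ of $S_2$ with $\rho_J(n_j)<\rho_I(n_j)$ for some $j$ and $\rho_J(n_l)\le\rho_I(n_l)$ for all $l\ne j$. A looping refinement is a binary relation between schemata contained in the looping relation. -}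

module Defs where

open import Data.Nat using (ℕ; _≟_)
open import Data.Integer using (ℤ; _+_; _-_; _*_; _≤_; _<_)
open import Data.Bool using (Bool; true; if_then_else_)
open import Data.List using (List; map)
open import Data.Product using (_×_; Σ; ∃; ∃-syntax; _,_)
open import Data.Sum using (_⊎_)
open import Data.Unit using (⊤)
open import Data.Empty using (⊥)
open import Relation.Nullary using (¬_)
open import Relation.Nullary.Decidable using (⌊_⌋)
open import Relation.Binary.PropositionalEquality using (_≡_; _≢_)
open import Function.Bundles using (_⇔_)

Var : Set
Var = ℕ

data LExpr : Set where
  const : ℤ → LExpr
  var   : Var → LExpr
  _⊕_   : LExpr → LExpr → LExpr
  _⊖_   : LExpr → LExpr → LExpr
  _⊛_   : ℤ → LExpr → LExpr

data Constraint : Set where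
  ctrue cfalse : Constraint
  _≤ᶜ_ _≐ᶜ_    : LExpr → LExpr → Constraint
  cnot         : Constraint → Constraint
  cand cor     : Constraint → Constraint → Constraint
  cex call     : Var → Constraint → Constraint

-- Patterns: indexed propositions p_{e1..ek}, negation, ∧, ∨ and
-- iterated connectives ⋀_{i | φ} P and ⋁_{i | φ} P (i bound).
data Pattern : Set where
  atom   : ℕ → List LExpr → Pattern
  pnot   : Pattern → Pattern
  pand   : Pattern → Pattern → Pattern
  por    : Pattern → Pattern → Pattern
  bigAnd : Var → Constraint → Pattern → Pattern
  bigOr  : Var → Constraint → Pattern → Pattern

record Schema : Set where
  constructor _∧ˢ_
  field
    pat : Pattern
    con : Constraint
open Schema public

OccE : Var → LExpr → Set
OccE x (const _) = ⊥
OccE x (var y)   = x ≡ y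
OccE x (a ⊕ b)   = OccE x a ⊎ OccE x b
OccE x (a ⊖ b)   = OccE x a ⊎ OccE x b
OccE x (c ⊛ a)   = OccE x a

OccEs : Var → List LExpr → Set
OccEs x List.[]       = ⊥
OccEs x (e List.∷ es) = OccE x e ⊎ OccEs x es

FreeC : Var → Constraint → Set
FreeC x ctrue      = ⊥
FreeC x cfalse     = ⊥
FreeC x (a ≤ᶜ b)   = OccE x a ⊎ OccE x b
FreeC x (a ≐ᶜ b)   = OccE x a ⊎ OccE x b
FreeC x (cnot φ)   = FreeC x φ
FreeC x (cand φ ψ) = FreeC x φ ⊎ FreeC x ψ
FreeC x (cor φ ψ)  = FreeC x φ ⊎ FreeC x ψ
FreeC x (cex y φ)  = x ≢ y × FreeC x φ
FreeC x (call y φ) = x ≢ y × FreeC x φ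

FreeP : Var → Pattern → Set
FreeP x (atom p es)    = OccEs x es
FreeP x (pnot P)       = FreeP x P
FreeP x (pand P Q)     = FreeP x P ⊎ FreeP x Q
FreeP x (por P Q)      = FreeP x P ⊎ FreeP x Q
FreeP x (bigAnd i φ P) = x ≢ i × (FreeC x φ ⊎ FreeP x P)
FreeP x (bigOr i φ P)  = x ≢ i × (FreeC x φ ⊎ FreeP x P)

IsParam : Schema → Var → Set
IsParam S x = FreeP x (pat S)

SameParams : Schema → Schema → Set
SameParams S₁ S₂ = ∀ x → IsParam S₁ x ⇔ IsParam S₂ x

substE : Var → LExpr → LExpr → LExpr
substE n e (const c) = const c
substE n e (var y)   = if ⌊ y ≟ n ⌋ then e else var y
substE n e (a ⊕ b)   = substE n e a ⊕ substE n e b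
substE n e (a ⊖ b)   = substE n e a ⊖ substE n e b
substE n e (c ⊛ a)   = c ⊛ substE n e a

substC : Var → LExpr → Constraint → Constraint
substC n e ctrue      = ctrue
substC n e cfalse     = cfalse
substC n e (a ≤ᶜ b)   = substE n e a ≤ᶜ substE n e b
substC n e (a ≐ᶜ b)   = substE n e a ≐ᶜ substE n e b
substC n e (cnot φ)   = cnot (substC n e φ)
substC n e (cand φ ψ) = cand (substC n e φ) (substC n e ψ)
substC n e (cor φ ψ)  = cor (substC n e φ) (substC n e ψ)
substC n e (cex y φ)  = cex y (if ⌊ y ≟ n ⌋ then φ else substC n e φ)
substC n e (call y φ) = call y (if ⌊ y ≟ n ⌋ then φ else substC n e φ)

substP : Var → LExpr → Pattern → Pattern
substP n e (atom p es)    = atom p (map (substE n e) es)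
substP n e (pnot P)       = pnot (substP n e P)
substP n e (pand P Q)     = pand (substP n e P) (substP n e Q)
substP n e (por P Q)      = por (substP n e P) (substP n e Q)
substP n e (bigAnd i φ P) =
  if ⌊ i ≟ n ⌋ then bigAnd i φ P else bigAnd i (substC n e φ) (substP n e P)
substP n e (bigOr i φ P)  =
  if ⌊ i ≟ n ⌋ then bigOr i φ P else bigOr i (substC n e φ) (substP n e P)

substS : Var → LExpr → Schema → Schema
substS n e S = substP n e (pat S) ∧ˢ substC n e (con S)

shift : Var → ℤ → Schema → Schema
shift n k S = substS n (var n ⊖ const k) S

-- Assignment of integers to variables (an environment, extended to all
-- variables; only the values of parameters matter).
Assign : Set
Assign = Var → ℤ

_[_↦_] : Assign → Var → ℤ → Assign
(ρ [ x ↦ v ]) y = if ⌊ y ≟ x ⌋ then v else ρ y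

evalE : Assign → LExpr → ℤ
evalE ρ (const c) = c
evalE ρ (var y)   = ρ y
evalE ρ (a ⊕ b)   = evalE ρ a + evalE ρ b
evalE ρ (a ⊖ b)   = evalE ρ a - evalE ρ b
evalE ρ (c ⊛ a)   = c * evalE ρ a

SatC : Assign → Constraint → Set
SatC ρ ctrue      = ⊤
SatC ρ cfalse     = ⊥
SatC ρ (a ≤ᶜ b)   = evalE ρ a ≤ evalE ρ b
SatC ρ (a ≐ᶜ b)   = evalE ρ a ≡ evalE ρ b
SatC ρ (cnot φ)   = ¬ SatC ρ φ
SatC ρ (cand φ ψ) = SatC ρ φ × SatC ρ ψ
SatC ρ (cor φ ψ)  = SatC ρ φ ⊎ SatC ρ ψ
SatC ρ (cex y φ)  = ∃[ m ] SatC (ρ [ y ↦ m ]) φ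
SatC ρ (call y φ) = ∀ m → SatC (ρ [ y ↦ m ]) φ

-- Propositional interpretation of ground indexed propositions p_{m1..mk}.
Valuation : Set
Valuation = ℕ → List ℤ → Bool

SatP : Assign → Valuation → Pattern → Set
SatP ρ v (atom p es)    = v p (map (evalE ρ) es) ≡ true
SatP ρ v (pnot P)       = ¬ SatP ρ v P
SatP ρ v (pand P Q)     = SatP ρ v P × SatP ρ v Q
SatP ρ v (por P Q)      = SatP ρ v P ⊎ SatP ρ v Q
SatP ρ v (bigAnd i φ P) =
  ∀ m → SatC (ρ [ i ↦ m ]) φ → SatP (ρ [ i ↦ m ]) v P
SatP ρ v (bigOr i φ P)  =
  ∃[ m ] (SatC (ρ [ i ↦ m ]) φ × SatP (ρ [ i ↦ m ]) v P)

-- φ encloses i: for every value of the other variables, the set of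
-- integers m with φ{m/i} true is bounded (hence finite).
Encloses : Var → Constraint → Set
Encloses i φ = ∀ (ρ : Assign) → ∃[ lo ] ∃[ hi ]
  (∀ m → SatC (ρ [ i ↦ m ]) φ → lo ≤ m × m ≤ hi)

WFP : Pattern → Set
WFP (atom p es)    = ⊤
WFP (pnot P)       = WFP P
WFP (pand P Q)     = WFP P × WFP Q
WFP (por P Q)      = WFP P × WFP Q
WFP (bigAnd i φ P) = Encloses i φ × WFP P
WFP (bigOr i φ P)  = Encloses i φ × WFP P

WFS : Schema → Set
WFS S = WFP (pat S)

record Interp : Set where
  constructor interp
  field
    env : Assign
    val : Valuation
open Interp public

Model : Schema → Interp → Set
Model S I = SatC (env I) (con S) × SatP (env I) (val I) (pat S)

Loops : Schema → Schema → Set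
Loops S₁ S₂ = SameParams S₁ S₂ ×
  (∀ I → Model S₁ I → ∃[ J ] (Model S₂ J ×
     ∃[ j ] (IsParam S₁ j × env J j < env I j ×
       (∀ l → IsParam S₁ l → l ≢ j → env J l ≤ env I l))))

-- A model I of S₂{n−k/n} becomes a model of S₂ once the value of n is
-- lowered from ρ_I(n) to ρ_I(n) − k (the substitution lemma), and every
-- other parameter keeps its value; as k > 0, n strictly decreases. The
-- expression n − k has n as its only variable, so the substitution neither
-- creates nor removes free variables, and S₁, S₂ have the same parameters.
module Submission where

open import Defs
open import Data.Integer using (ℤ; _<_; +_)
open import Relation.Binary.PropositionalEquality using (_≡_)

open import Data.Nat using (_≟_)
open import Data.Integer using (_+_; _-_; _*_; _≤_)
open import Data.Integer.Properties using (+-monoʳ-<; neg-mono-<; +-identityʳ; ≤-reflexive)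
open import Data.List using ([]; _∷_; map)
open import Data.List.Properties using (map-cong)
open import Data.Bool using (true)
open import Data.Product using (_×_; _,_)
open import Data.Sum using (inj₁; inj₂)
open import Data.Empty using (⊥-elim)
open import Relation.Nullary using (yes; no)
open import Relation.Binary.PropositionalEquality
  using (refl; sym; trans; cong; cong₂; subst; _≢_; _≗_)
open import Function.Base using (_∘_)
open import Function.Bundles using (_⇔_; mk⇔; module Equivalence)
open import Function.Construct.Identity using (⇔-id)
open import Function.Related.Propositional using (K-reflexive)
open import Function.Related.TypeIsomorphisms using (→-cong-⇔; ¬-cong-⇔)
open import Data.Product.Function.NonDependent.Propositional using (_×-⇔_)
open import Data.Sum.Function.Propositional using (_⊎-⇔_)
import Data.Product.Function.Dependent.Propositional as Σ

open Equivalence using (to; from)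

∀-cong-⇔ : {A : Set} {B C : A → Set} → (∀ x → B x ⇔ C x) → (∀ x → B x) ⇔ (∀ x → C x)
∀-cong-⇔ B⇔C = mk⇔ (λ f x → to (B⇔C x) (f x)) (λ g x → from (B⇔C x) (g x))

i-j<i : ∀ i {j} → + 0 < j → i - j < i
i-j<i i 0<j = subst (i - _ <_) (+-identityʳ i) (+-monoʳ-< i (neg-mono-< 0<j))

update-≡ : ∀ (ρ : Assign) x v → (ρ [ x ↦ v ]) x ≡ v
update-≡ ρ x v with x ≟ x
... | yes _   = refl
... | no x≢x = ⊥-elim (x≢x refl)

update-≢ : ∀ (ρ : Assign) {x y} v → y ≢ x → (ρ [ x ↦ v ]) y ≡ ρ y
update-≢ ρ {x} {y} v y≢x with y ≟ x
... | yes y≡x = ⊥-elim (y≢x y≡x)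
... | no _    = refl

update-cong : ∀ {ρ σ : Assign} → ρ ≗ σ → ∀ y m → ρ [ y ↦ m ] ≗ σ [ y ↦ m ]
update-cong ρ≗σ y m x with x ≟ y
... | yes _ = refl
... | no _  = ρ≗σ x

evalE-local : ∀ {ρ σ : Assign} a → (∀ x → OccE x a → ρ x ≡ σ x) → evalE ρ a ≡ evalE σ a
evalE-local (const c) agree = refl
evalE-local (var y)   agree = agree y refl
evalE-local (a ⊕ b)   agree =
  cong₂ _+_ (evalE-local a (λ x → agree x ∘ inj₁)) (evalE-local b (λ x → agree x ∘ inj₂))
evalE-local (a ⊖ b)   agree =
  cong₂ _-_ (evalE-local a (λ x → agree x ∘ inj₁)) (evalE-local b (λ x → agree x ∘ inj₂))
evalE-local (c ⊛ a)   agree = cong (c *_) (evalE-local a agree)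

evalE-cong : ∀ {ρ σ : Assign} → ρ ≗ σ → evalE ρ ≗ evalE σ
evalE-cong ρ≗σ a = evalE-local a (λ x _ → ρ≗σ x)

satC-cong : ∀ {ρ σ} → ρ ≗ σ → ∀ φ → SatC ρ φ ⇔ SatC σ φ
satC-cong ρ≗σ ctrue      = ⇔-id _
satC-cong ρ≗σ cfalse     = ⇔-id _
satC-cong ρ≗σ (a ≤ᶜ b)   = K-reflexive (cong₂ _≤_ (evalE-cong ρ≗σ a) (evalE-cong ρ≗σ b))
satC-cong ρ≗σ (a ≐ᶜ b)   = K-reflexive (cong₂ _≡_ (evalE-cong ρ≗σ a) (evalE-cong ρ≗σ b))
satC-cong ρ≗σ (cnot φ)   = ¬-cong-⇔ (satC-cong ρ≗σ φ)
satC-cong ρ≗σ (cand φ ψ) = satC-cong ρ≗σ φ ×-⇔ satC-cong ρ≗σ ψ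
satC-cong ρ≗σ (cor φ ψ)  = satC-cong ρ≗σ φ ⊎-⇔ satC-cong ρ≗σ ψ
satC-cong ρ≗σ (cex y φ)  = Σ.congˡ λ {m} → satC-cong (update-cong ρ≗σ y m) φ
satC-cong ρ≗σ (call y φ) = ∀-cong-⇔ λ m → satC-cong (update-cong ρ≗σ y m) φ

satP-cong : ∀ {ρ σ} v → ρ ≗ σ → ∀ P → SatP ρ v P ⇔ SatP σ v P
satP-cong v ρ≗σ (atom p es) =
  K-reflexive (cong (λ vs → v p vs ≡ true) (map-cong (evalE-cong ρ≗σ) es))
satP-cong v ρ≗σ (pnot P)       = ¬-cong-⇔ (satP-cong v ρ≗σ P)
satP-cong v ρ≗σ (pand P Q)     = satP-cong v ρ≗σ P ×-⇔ satP-cong v ρ≗σ Q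
satP-cong v ρ≗σ (por P Q)      = satP-cong v ρ≗σ P ⊎-⇔ satP-cong v ρ≗σ Q
satP-cong v ρ≗σ (bigAnd i φ P) = ∀-cong-⇔ λ m →
  →-cong-⇔ (satC-cong (update-cong ρ≗σ i m) φ) (satP-cong v (update-cong ρ≗σ i m) P)
satP-cong v ρ≗σ (bigOr i φ P)  = Σ.congˡ λ {m} →
  satC-cong (update-cong ρ≗σ i m) φ ×-⇔ satP-cong v (update-cong ρ≗σ i m) P

-- Capture is impossible because n is the only variable of e, and binders
-- named n stop the substitution.
module Substitution (n : Var) (e : LExpr) (vars-e : ∀ x → OccE x e ⇔ x ≡ n) where

  SubstEnv : Assign → Assign → Set
  SubstEnv ρ σ = σ n ≡ evalE ρ e × (∀ x → x ≢ n → σ x ≡ ρ x)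

  substEnv-canonical : ∀ ρ → SubstEnv ρ (ρ [ n ↦ evalE ρ e ])
  substEnv-canonical ρ = update-≡ ρ n _ , λ x → update-≢ ρ _

  substEnv-update : ∀ {ρ σ} → SubstEnv ρ σ → ∀ {y} m → y ≢ n →
                    SubstEnv (ρ [ y ↦ m ]) (σ [ y ↦ m ])
  substEnv-update {ρ} {σ} (σn , σx) {y} m y≢n =
    trans (update-≢ σ m (y≢n ∘ sym)) (trans σn e-unchanged) , agree
    where
      e-unchanged : evalE ρ e ≡ evalE (ρ [ y ↦ m ]) e
      e-unchanged = evalE-local e λ x x∈e →
        sym (update-≢ ρ m λ x≡y → y≢n (trans (sym x≡y) (to (vars-e x) x∈e)))
      agree : ∀ x → x ≢ n → (σ [ y ↦ m ]) x ≡ (ρ [ y ↦ m ]) x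
      agree x x≢n with x ≟ y
      ... | yes _ = refl
      ... | no _  = σx x x≢n

  substEnv-update-n : ∀ {ρ σ} → SubstEnv ρ σ → ∀ m → ρ [ n ↦ m ] ≗ σ [ n ↦ m ]
  substEnv-update-n (_ , σx) m x with x ≟ n
  ... | yes _   = refl
  ... | no x≢n = sym (σx x x≢n)

  evalE-subst : ∀ {ρ σ} → SubstEnv ρ σ → ∀ a → evalE ρ (substE n e a) ≡ evalE σ a
  evalE-subst r (const c) = refl
  evalE-subst (σn , σx) (var y) with y ≟ n
  ... | yes refl = sym σn
  ... | no y≢n   = sym (σx y y≢n)
  evalE-subst r (a ⊕ b) = cong₂ _+_ (evalE-subst r a) (evalE-subst r b)
  evalE-subst r (a ⊖ b) = cong₂ _-_ (evalE-subst r a) (evalE-subst r b)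
  evalE-subst r (c ⊛ a) = cong (c *_) (evalE-subst r a)

  satC-subst : ∀ {ρ σ} → SubstEnv ρ σ → ∀ φ → SatC ρ (substC n e φ) ⇔ SatC σ φ
  satC-subst r ctrue      = ⇔-id _
  satC-subst r cfalse     = ⇔-id _
  satC-subst r (a ≤ᶜ b)   = K-reflexive (cong₂ _≤_ (evalE-subst r a) (evalE-subst r b))
  satC-subst r (a ≐ᶜ b)   = K-reflexive (cong₂ _≡_ (evalE-subst r a) (evalE-subst r b))
  satC-subst r (cnot φ)   = ¬-cong-⇔ (satC-subst r φ)
  satC-subst r (cand φ ψ) = satC-subst r φ ×-⇔ satC-subst r ψ
  satC-subst r (cor φ ψ)  = satC-subst r φ ⊎-⇔ satC-subst r ψ
  satC-subst r (cex y φ) with y ≟ n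
  ... | yes refl = Σ.congˡ λ {m} → satC-cong (substEnv-update-n r m) φ
  ... | no y≢n   = Σ.congˡ λ {m} → satC-subst (substEnv-update r m y≢n) φ
  satC-subst r (call y φ) with y ≟ n
  ... | yes refl = ∀-cong-⇔ λ m → satC-cong (substEnv-update-n r m) φ
  ... | no y≢n   = ∀-cong-⇔ λ m → satC-subst (substEnv-update r m y≢n) φ

  satP-subst : ∀ {ρ σ} v → SubstEnv ρ σ → ∀ P → SatP ρ v (substP n e P) ⇔ SatP σ v P
  satP-subst v r (atom p es) =
    K-reflexive (cong (λ vs → v p vs ≡ true) (evalEs-subst es))
    where
      evalEs-subst : ∀ es → map (evalE _) (map (substE n e) es) ≡ map (evalE _) es
      evalEs-subst []       = refl
      evalEs-subst (a ∷ es) = cong₂ _∷_ (evalE-subst r a) (evalEs-subst es)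
  satP-subst v r (pnot P)   = ¬-cong-⇔ (satP-subst v r P)
  satP-subst v r (pand P Q) = satP-subst v r P ×-⇔ satP-subst v r Q
  satP-subst v r (por P Q)  = satP-subst v r P ⊎-⇔ satP-subst v r Q
  satP-subst v r (bigAnd i φ P) with i ≟ n
  ... | yes refl = ∀-cong-⇔ λ m →
    →-cong-⇔ (satC-cong (substEnv-update-n r m) φ) (satP-cong v (substEnv-update-n r m) P)
  ... | no i≢n   = ∀-cong-⇔ λ m →
    →-cong-⇔ (satC-subst (substEnv-update r m i≢n) φ) (satP-subst v (substEnv-update r m i≢n) P)
  satP-subst v r (bigOr i φ P) with i ≟ n
  ... | yes refl = Σ.congˡ λ {m} →
    satC-cong (substEnv-update-n r m) φ ×-⇔ satP-cong v (substEnv-update-n r m) P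
  ... | no i≢n   = Σ.congˡ λ {m} →
    satC-subst (substEnv-update r m i≢n) φ ×-⇔ satP-subst v (substEnv-update r m i≢n) P

  model-subst : ∀ S I → Model (substS n e S) I →
                Model S (interp (env I [ n ↦ evalE (env I) e ]) (val I))
  model-subst S I (sat-con , sat-pat) =
      to (satC-subst r (con S)) sat-con , to (satP-subst (val I) r (pat S)) sat-pat
    where r = substEnv-canonical (env I)

  occE-subst : ∀ x a → OccE x (substE n e a) ⇔ OccE x a
  occE-subst x (const c) = ⇔-id _
  occE-subst x (var y) with y ≟ n
  ... | yes refl = vars-e x
  ... | no _     = ⇔-id _
  occE-subst x (a ⊕ b) = occE-subst x a ⊎-⇔ occE-subst x b
  occE-subst x (a ⊖ b) = occE-subst x a ⊎-⇔ occE-subst x b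
  occE-subst x (c ⊛ a) = occE-subst x a

  occEs-subst : ∀ x es → OccEs x (map (substE n e) es) ⇔ OccEs x es
  occEs-subst x []       = ⇔-id _
  occEs-subst x (a ∷ es) = occE-subst x a ⊎-⇔ occEs-subst x es

  freeC-subst : ∀ x φ → FreeC x (substC n e φ) ⇔ FreeC x φ
  freeC-subst x ctrue      = ⇔-id _
  freeC-subst x cfalse     = ⇔-id _
  freeC-subst x (a ≤ᶜ b)   = occE-subst x a ⊎-⇔ occE-subst x b
  freeC-subst x (a ≐ᶜ b)   = occE-subst x a ⊎-⇔ occE-subst x b
  freeC-subst x (cnot φ)   = freeC-subst x φ
  freeC-subst x (cand φ ψ) = freeC-subst x φ ⊎-⇔ freeC-subst x ψ
  freeC-subst x (cor φ ψ)  = freeC-subst x φ ⊎-⇔ freeC-subst x ψ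
  freeC-subst x (cex y φ) with y ≟ n
  ... | yes _ = ⇔-id _
  ... | no _  = ⇔-id _ ×-⇔ freeC-subst x φ
  freeC-subst x (call y φ) with y ≟ n
  ... | yes _ = ⇔-id _
  ... | no _  = ⇔-id _ ×-⇔ freeC-subst x φ

  freeP-subst : ∀ x P → FreeP x (substP n e P) ⇔ FreeP x P
  freeP-subst x (atom p es) = occEs-subst x es
  freeP-subst x (pnot P)    = freeP-subst x P
  freeP-subst x (pand P Q)  = freeP-subst x P ⊎-⇔ freeP-subst x Q
  freeP-subst x (por P Q)   = freeP-subst x P ⊎-⇔ freeP-subst x Q
  freeP-subst x (bigAnd i φ P) with i ≟ n
  ... | yes _ = ⇔-id _
  ... | no _  = ⇔-id _ ×-⇔ (freeC-subst x φ ⊎-⇔ freeP-subst x P)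
  freeP-subst x (bigOr i φ P) with i ≟ n
  ... | yes _ = ⇔-id _
  ... | no _  = ⇔-id _ ×-⇔ (freeC-subst x φ ⊎-⇔ freeP-subst x P)

  sameParams-subst : ∀ S → SameParams (substS n e S) S
  sameParams-subst S x = freeP-subst x (pat S)

shift-vars : ∀ n k x → OccE x (var n ⊖ const k) ⇔ x ≡ n
shift-vars n k x = mk⇔ (λ { (inj₁ x≡n) → x≡n ; (inj₂ ()) }) inj₁

proposition4 : (n : Var) (k : ℤ) (S₁ S₂ : Schema) →
    WFS S₁ → WFS S₂ → IsParam S₁ n → IsParam S₂ n →
    + 0 < k → S₁ ≡ shift n k S₂ → Loops S₁ S₂
proposition4 n k .(shift n k S₂) S₂ _ _ n∈S₁ _ 0<k refl =
  sameParams-subst S₂ ,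
  λ I model₁ →
    let ρ = env I in
    interp (ρ [ n ↦ ρ n - k ]) (val I) , model-subst S₂ I model₁ ,
    n , n∈S₁ ,
    subst (_< ρ n) (sym (update-≡ ρ n (ρ n - k))) (i-j<i (ρ n) 0<k) ,
    λ l _ l≢n → ≤-reflexive (update-≢ ρ (ρ n - k) l≢n)
  where open Substitution n (var n ⊖ const k) (shift-vars n k)
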